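{- Let $p,q,n$ be positive integers with $n\ge 3$, and let $C_n$ denote the cycle graph on $n$ vertices. Then \[ \hom(K_{p,q},C_n)=\begin{cases} n\,(2^p+2^q-2), & \text{if } n=3 \text{ or } n\ge 5,\\ 2^{p+q+1}, & \text{if } n=4.\end{cases} \]
   Context: $\hom(F,G)$ is the number of maps $\phi:V(F)\to V(G)$ such that $\{\phi(u),\phi(v)\}\in E(G)$ whenever $\{u,v\}\in E(F)$. $K_{p,q}$ is the complete bipartite graph with partite sets of sizes $p$ and $q$. -}

module Defs where

open import Data.Nat using (ℕ; zero; suc; _+_; _*_; _≡ᵇ_; NonZero)
open import Data.Nat.DivMod using (_%_)
open import Data.Bool using (Bool; true; false; _∧_; _∨_; not; if_then_else_)
open import Data.Fin using (Fin; toℕ; splitAt)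
open import Data.Sum using (inj₁; inj₂)
open import Data.List using (List; []; _∷_; map; concatMap; allFin; length; filter)
open import Data.Bool.ListAction using (and)
open import Data.Vec using (Vec; []; _∷_; lookup)
open import Function using (_∘_)
open import Relation.Nullary.Decidable using (yes; no)
open import Data.Bool.Properties using (T?)

record Graph : Set where
  field
    size : ℕ
    adj  : Fin size → Fin size → Bool
open Graph public

-- all vectors of length m over Fin k, i.e. all maps Fin m → Fin k (as lookup tables)
allVecs : (m k : ℕ) → List (Vec (Fin k) m)
allVecs zero    k = [] ∷ []
allVecs (suc m) k = concatMap (λ x → map (x ∷_) (allVecs m k)) (allFin k)

isHom : (F G : Graph) → Vec (Fin (size G)) (size F) → Bool
isHom F G φ =
  and (concatMap (λ u → map (λ v → not (adj F u v) ∨ adj G (lookup φ u) (lookup φ v))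
                            (allFin (size F)))
                 (allFin (size F)))

hom : Graph → Graph → ℕ
hom F G = length (filter (λ φ → T? (isHom F G φ)) (allVecs (size F) (size G)))

K : ℕ → ℕ → Graph
K p q = record { size = p + q ; adj = a }
  where
  a : Fin (p + q) → Fin (p + q) → Bool
  a u v with splitAt p u | splitAt p v
  ... | inj₁ _ | inj₂ _ = true
  ... | inj₂ _ | inj₁ _ = true
  ... | _      | _      = false

-- cycle graph C_n on vertices 0..n-1, i ~ j iff j ≡ i+1 (mod n) or i ≡ j+1 (mod n)
-- (intended for n ≥ 3, where this is a simple cycle)
-- (n = 0 gives the empty graph; the statement only uses n ≥ 3)
C : ℕ → Graph
C zero    = record { size = zero ; adj = λ () }
C (suc m) = record { size = suc m ; adj = λ i j → (toℕ j ≡ᵇ (suc (toℕ i) % suc m)) ∨ (toℕ i ≡ᵇ (suc (toℕ j) % suc m)) }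

{-# OPTIONS --safe #-}
module Submission where

-- Recording the images xs of the p-side first, hom(K_{p,q}, G) = Σ_xs |N(xs)|^q, where N(xs) is the
-- common neighbourhood of xs. Fixing the first vertex u of xs turns this into a recursion over the
-- sets N(u) ∩ N(w). Let G be d-regular on n vertices, so that Σ_w |N(u) ∩ N(w)| = d².
-- If G has no 4-cycle then |N(u) ∩ N(w)| ≤ 1 for w ≠ u, such a term contributes |N(u) ∩ N(w)| d^m
-- whatever q is, and the recursion gives hom(K_{p,q}, G) = n (d^p + d^q - d).
-- If any two neighbourhoods are equal or disjoint, as in C₄, the recursion multiplies by d at each
-- step and hom(K_{p,q}, G) = n d^(p+q-1).
-- Finally C_n (n ≥ 3) is the graph of the rotation i ↦ i + 1 mod n, so it is 2-regular, and it
-- contains a 4-cycle only if the rotation by 4 has a fixed point, that is, only if n = 4.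

open import Defs
import Algebra.Properties.CommutativeMonoid.Sum
open import Data.Bool using (Bool; true; false; _∧_; _∨_; not; T)
open import Data.Bool.ListAction using (and)
open import Data.Bool.Properties
  using (∧-assoc; ∧-idem; ∧-identityʳ; ∨-comm; ∧-commutativeMonoid; T-∧; T-∨) renaming (_≟_ to _≟ᵇ_)
open import Data.Empty using (⊥; ⊥-elim)
open import Data.Fin using (Fin; zero; suc; _↑ˡ_; _↑ʳ_; punchIn; toℕ; fromℕ<)
open import Data.Fin.Properties
  using (_≟_; any?; all?; punchInᵢ≢i; splitAt-↑ˡ; splitAt-↑ʳ; toℕ-fromℕ<; toℕ-injective; toℕ<n)
open import Data.List using (List; []; _∷_; _++_; map; concatMap; tabulate; allFin; filter; length)
open import Data.List.Properties using (filter-++; length-++; map-tabulate)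
open import Data.Nat using (ℕ; zero; suc; _+_; _*_; _∸_; _^_; _≤_; _<_; _≡ᵇ_; z≤n; s≤s; NonZero)
open import Data.Nat.DivMod
  using (_%_; _/_; m≡m%n+[m/n]*n; m*n%n≡0; %-distribˡ-+; m%n%n≡m%n; [m+n]%n≡m%n; m<n⇒m%n≡m; m%n<n)
open import Data.Nat.GeneralisedArithmetic using (fold)
open import Data.Nat.Properties
  using ( +-*-semiring; +-commutativeSemigroup; ≡ᵇ⇒≡; ≡⇒≡ᵇ; ≤-refl; ≤-reflexive; ≤-trans; <-irrefl
        ; +-comm; +-suc; +-identityʳ; +-mono-≤; +-cancelʳ-≡; m+n∸n≡m
        ; *-assoc; *-identityˡ; *-identityʳ; *-zeroʳ; *-cancelˡ-≡; ^-zeroˡ; ^-distribˡ-+-* )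
open import Data.Product using (_×_; _,_)
open import Data.Sum using (_⊎_; inj₁; inj₂) renaming (map to ⊎-map)
open import Data.Vec using (Vec; []; _∷_; lookup) renaming (_++_ to _++ᵛ_)
open import Data.Vec.Properties using (lookup-++ˡ; lookup-++ʳ)
open import Function using (_∘_)
open import Function.Bundles using (Equivalence)
open import Relation.Binary.PropositionalEquality
  using (_≡_; _≢_; _≗_; refl; sym; trans; cong; cong₂; subst; module ≡-Reasoning)
open import Relation.Nullary using (¬_; yes; no)
open import Relation.Nullary.Decidable using (T?; ⌊_⌋; toWitness; fromWitness; _⊎-dec_)

open import Algebra.Properties.Semiring.Sum +-*-semiring
open import Algebra.Properties.CommutativeSemigroup +-commutativeSemigroup using (xy∙z≈xz∙y)
module ⋀ = Algebra.Properties.CommutativeMonoid.Sum ∧-commutativeMonoid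

⋀-syntax : ∀ n → (Fin n → Bool) → Bool
⋀-syntax _ = ⋀.sum

syntax ⋀-syntax n (λ i → b) = ⋀[ i < n ] b

-- Sums and counts over Fin n

[_] : Bool → ℕ
[ true ]  = 1
[ false ] = 0

count : ∀ {n} → (Fin n → Bool) → ℕ
count {n} P = ∑[ i < n ] [ P i ]

[∧] : ∀ a b → [ a ∧ b ] ≡ [ a ] * [ b ]
[∧] true  b = sym (*-identityˡ [ b ])
[∧] false b = refl

[∧]≤ : ∀ a b → [ a ∧ b ] ≤ [ a ]
[∧]≤ true  true  = ≤-refl
[∧]≤ true  false = z≤n
[∧]≤ false b     = z≤n

[∨] : ∀ a b → (T a → T b → ⊥) → [ a ∨ b ] ≡ [ a ] + [ b ]
[∨] true  true  disjoint = ⊥-elim (disjoint _ _)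
[∨] true  false _ = refl
[∨] false b     _ = refl

[T] : ∀ {b} → T b → [ b ] ≡ 1
[T] {true} _ = refl

[¬T] : ∀ {b} → ¬ T b → [ b ] ≡ 0
[¬T] {true}  ¬b = ⊥-elim (¬b _)
[¬T] {false} _  = refl

∑-mono-≤ : ∀ {n} {f g : Fin n → ℕ} → (∀ i → f i ≤ g i) → sum f ≤ sum g
∑-mono-≤ {zero}  _   = z≤n
∑-mono-≤ {suc n} f≤g = +-mono-≤ (f≤g zero) (∑-mono-≤ (f≤g ∘ suc))

∑-const : ∀ n c → ∑[ i < n ] c ≡ n * c
∑-const zero    c = refl
∑-const (suc n) c = cong (c +_) (∑-const n c)

module _ {n : ℕ} where

  count-cong : {P Q : Fin n → Bool} → P ≗ Q → count P ≡ count Q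
  count-cong P≗Q = sum-cong-≗ (cong [_] ∘ P≗Q)

  count-∧-≤ : (P Q : Fin n → Bool) → count (λ i → P i ∧ Q i) ≤ count P
  count-∧-≤ P Q = ∑-mono-≤ (λ i → [∧]≤ (P i) (Q i))

  count-∨ : (P Q : Fin n → Bool) → (∀ i → T (P i) → T (Q i) → ⊥) →
            count (λ i → P i ∨ Q i) ≡ count P + count Q
  count-∨ P Q disjoint = trans (sum-cong-≗ (λ i → [∨] (P i) (Q i) (disjoint i)))
                               (∑-distrib-+ ([_] ∘ P) ([_] ∘ Q))

  count-none : {P : Fin n → Bool} → (∀ i → ¬ T (P i)) → count P ≡ 0
  count-none none = trans (sum-cong-≗ ([¬T] ∘ none)) (sum-replicate-zero n)

count-unique : ∀ {n} {P : Fin n → Bool} a → T (P a) → (∀ {i} → T (P i) → i ≡ a) → count P ≡ 1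
count-unique {suc n} {P} a Pa unique = begin
  count P
    ≡⟨ sum-remove {i = a} ([_] ∘ P) ⟩
  [ P a ] + ∑[ j < n ] [ P (punchIn a j) ]
    ≡⟨ cong₂ _+_ ([T] Pa) (count-none (λ j → punchInᵢ≢i a j ∘ unique)) ⟩
  1
    ∎
  where open ≡-Reasoning

count-atMostOne : ∀ {n} (P : Fin n → Bool) → (∀ {i j} → T (P i) → T (P j) → i ≡ j) → count P ≤ 1
count-atMostOne P atMostOne with any? (T? ∘ P)
... | yes (a , Pa) = ≤-reflexive (count-unique a Pa (λ Pi → atMostOne Pi Pa))
... | no  ∄a       = ≤-trans (≤-reflexive (count-none (λ i Pi → ∄a (i , Pi)))) z≤n

count-≟ : ∀ {n} (u : Fin n) → count (λ w → ⌊ u ≟ w ⌋) ≡ 1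
count-≟ u = count-unique u (fromWitness refl) (λ u≡w → sym (toWitness u≡w))

_∩_ : ∀ {n} → (Fin n → Bool) → (Fin n → Bool) → Fin n → Bool
(P ∩ Q) y = P y ∧ Q y

module _ {k : ℕ} where

  ∑ᵛ : (m : ℕ) → (Vec (Fin k) m → ℕ) → ℕ
  ∑ᵛ zero    f = f []
  ∑ᵛ (suc m) f = ∑[ x < k ] ∑ᵛ m (λ xs → f (x ∷ xs))

  ∑ᵛ-cong : ∀ m {f g : Vec (Fin k) m → ℕ} → f ≗ g → ∑ᵛ m f ≡ ∑ᵛ m g
  ∑ᵛ-cong zero    f≗g = f≗g []
  ∑ᵛ-cong (suc m) f≗g = sum-cong-≗ (λ x → ∑ᵛ-cong m (λ xs → f≗g (x ∷ xs)))

  ∑ᵛ-++ : ∀ p q (f : Vec (Fin k) (p + q) → ℕ) →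
          ∑ᵛ (p + q) f ≡ ∑ᵛ p (λ xs → ∑ᵛ q (λ ys → f (xs ++ᵛ ys)))
  ∑ᵛ-++ zero    q f = refl
  ∑ᵛ-++ (suc p) q f = sum-cong-≗ (λ x → ∑ᵛ-++ p q (λ zs → f (x ∷ zs)))

  ∑ᵛ-*ˡ : ∀ m c (f : Vec (Fin k) m → ℕ) → ∑ᵛ m (λ xs → c * f xs) ≡ c * ∑ᵛ m f
  ∑ᵛ-*ˡ zero    c f = refl
  ∑ᵛ-*ˡ (suc m) c f = trans (sum-cong-≗ (λ x → ∑ᵛ-*ˡ m c (λ xs → f (x ∷ xs))))
                            (sym (*-distribˡ-sum c (λ x → ∑ᵛ m (λ xs → f (x ∷ xs)))))

  ∑ᵛ-comm : ∀ m {n} (f : Vec (Fin k) m → Fin n → ℕ) →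
            ∑ᵛ m (λ xs → ∑[ y < n ] f xs y) ≡ ∑[ y < n ] ∑ᵛ m (λ xs → f xs y)
  ∑ᵛ-comm zero    f = refl
  ∑ᵛ-comm (suc m) f = trans (sum-cong-≗ (λ x → ∑ᵛ-comm m (λ xs → f (x ∷ xs))))
                            (∑-comm (λ x y → ∑ᵛ m (λ xs → f (x ∷ xs) y)))

  ∑ᵛ-all : ∀ m (P : Fin k → Bool) → ∑ᵛ m (λ xs → [ ⋀[ i < m ] P (lookup xs i) ]) ≡ count P ^ m
  ∑ᵛ-all zero    P = refl
  ∑ᵛ-all (suc m) P = begin
    ∑[ x < k ] ∑ᵛ m (λ xs → [ P x ∧ all xs ])
      ≡⟨ sum-cong-≗ (λ x → ∑ᵛ-cong m (λ xs → [∧] (P x) (all xs))) ⟩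
    ∑[ x < k ] ∑ᵛ m (λ xs → [ P x ] * [ all xs ])
      ≡⟨ sum-cong-≗ (λ x → ∑ᵛ-*ˡ m [ P x ] (λ xs → [ all xs ])) ⟩
    ∑[ x < k ] ([ P x ] * ∑ᵛ m (λ xs → [ all xs ]))
      ≡⟨ sum-cong-≗ (λ x → cong ([ P x ] *_) (∑ᵛ-all m P)) ⟩
    ∑[ x < k ] ([ P x ] * count P ^ m)
      ≡⟨ *-distribʳ-sum (count P ^ m) ([_] ∘ P) ⟨
    count P * count P ^ m
      ∎
    where
    open ≡-Reasoning
    all : Vec (Fin k) m → Bool
    all xs = ⋀[ i < m ] P (lookup xs i)

-- Lists and filters as sums

private
  variable
    A B : Set

and-++ : (bs cs : List Bool) → and (bs ++ cs) ≡ and bs ∧ and cs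
and-++ []       cs = refl
and-++ (b ∷ bs) cs = trans (cong (b ∧_) (and-++ bs cs)) (sym (∧-assoc b (and bs) (and cs)))

and-tabulate : ∀ {n} (f : Fin n → Bool) → and (tabulate f) ≡ ⋀[ i < n ] f i
and-tabulate {zero}  f = refl
and-tabulate {suc n} f = cong (f zero ∧_) (and-tabulate (f ∘ suc))

and-concatMap-tabulate : ∀ {n} (f : Fin n → A) (g : A → List Bool) →
                         and (concatMap g (tabulate f)) ≡ ⋀[ i < n ] and (g (f i))
and-concatMap-tabulate {n = zero}  f g = refl
and-concatMap-tabulate {n = suc n} f g =
  trans (and-++ (g (f zero)) _) (cong (and (g (f zero)) ∧_) (and-concatMap-tabulate (f ∘ suc) g))

length-filter-++ : (P : A → Bool) (xs ys : List A) →
  length (filter (T? ∘ P) (xs ++ ys)) ≡ length (filter (T? ∘ P) xs) + length (filter (T? ∘ P) ys)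
length-filter-++ P xs ys = trans (cong length (filter-++ (T? ∘ P) xs ys)) (length-++ (filter (T? ∘ P) xs))

length-filter-map : (P : B → Bool) (f : A → B) (xs : List A) →
  length (filter (T? ∘ P) (map f xs)) ≡ length (filter (T? ∘ P ∘ f) xs)
length-filter-map P f []       = refl
length-filter-map P f (x ∷ xs) with P (f x)
... | true  = cong suc (length-filter-map P f xs)
... | false = length-filter-map P f xs

length-filter-concatMap-tabulate : ∀ {n} (P : B → Bool) (f : Fin n → A) (g : A → List B) →
  length (filter (T? ∘ P) (concatMap g (tabulate f))) ≡ ∑[ i < n ] length (filter (T? ∘ P) (g (f i)))
length-filter-concatMap-tabulate {n = zero}  P f g = refl
length-filter-concatMap-tabulate {n = suc n} P f g =
  trans (length-filter-++ P (g (f zero)) _) (cong (_ +_) (length-filter-concatMap-tabulate P (f ∘ suc) g))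

length-filter-allVecs : ∀ {k} m (P : Vec (Fin k) m → Bool) →
                        length (filter (T? ∘ P) (allVecs m k)) ≡ ∑ᵛ m ([_] ∘ P)
length-filter-allVecs zero P with P []
... | true  = refl
... | false = refl
length-filter-allVecs {k} (suc m) P =
  trans (length-filter-concatMap-tabulate P (λ x → x) (λ x → map (x ∷_) (allVecs m k)))
        (sum-cong-≗ (λ x → trans (length-filter-map P (x ∷_) (allVecs m k))
                                 (length-filter-allVecs m (P ∘ (x ∷_)))))

preservesEdge : (F G : Graph) → Vec (Fin (size G)) (size F) → Fin (size F) → Fin (size F) → Bool
preservesEdge F G φ u v = not (adj F u v) ∨ adj G (lookup φ u) (lookup φ v)

isHom-⋀ : ∀ F G φ → isHom F G φ ≡ ⋀[ u < size F ] ⋀[ v < size F ] preservesEdge F G φ u v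
isHom-⋀ F G φ =
  trans (and-concatMap-tabulate (λ u → u) (λ u → map (preservesEdge F G φ u) (allFin (size F))))
        (⋀.sum-cong-≗ (λ u → trans (cong and (map-tabulate (λ v → v) (preservesEdge F G φ u)))
                                   (and-tabulate (preservesEdge F G φ u))))

⋀-↑ : ∀ p q (f : Fin (p + q) → Bool) →
      ⋀[ u < p + q ] f u ≡ ⋀[ i < p ] f (i ↑ˡ q) ∧ ⋀[ j < q ] f (p ↑ʳ j)
⋀-↑ zero    q f = refl
⋀-↑ (suc p) q f = trans (cong (f zero ∧_) (⋀-↑ p q (f ∘ suc))) (sym (∧-assoc (f zero) _ _))

⋀-true : ∀ n → ⋀[ i < n ] true ≡ true
⋀-true = ⋀.sum-replicate-zero

-- Homomorphisms from K_{p,q}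

Undirected : Graph → Set
Undirected G = ∀ u v → adj G u v ≡ adj G v u

Regular : ℕ → Graph → Set
Regular d G = ∀ u → count (adj G u) ≡ d

C₄-free : Graph → Set
C₄-free G = ∀ {u w} → u ≢ w → count (adj G u ∩ adj G w) ≤ 1

NeighbourhoodsEqualOrDisjoint : Graph → Set
NeighbourhoodsEqualOrDisjoint G =
  ∀ u w → (adj G u ∩ adj G w ≗ adj G u) ⊎ (adj G u ∩ adj G w ≗ λ _ → false)

common : (G : Graph) {m : ℕ} → Vec (Fin (size G)) m → Fin (size G) → Bool
common G {m} xs y = ⋀[ i < m ] adj G (lookup xs i) y

module _ (G : Graph) (undirected : Undirected G) where

  module _ {p q} (xs : Vec (Fin (size G)) p) (ys : Vec (Fin (size G)) q) where

    private
      edge : Fin (p + q) → Fin (p + q) → Bool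
      edge = preservesEdge (K p q) G (xs ++ᵛ ys)
      a : Fin p → Fin q → Bool
      a i j = adj G (lookup xs i) (lookup ys j)

    edge-↑ˡ-↑ˡ : ∀ i i′ → edge (i ↑ˡ q) (i′ ↑ˡ q) ≡ true
    edge-↑ˡ-↑ˡ i i′ rewrite splitAt-↑ˡ p i q | splitAt-↑ˡ p i′ q = refl

    edge-↑ˡ-↑ʳ : ∀ i j → edge (i ↑ˡ q) (p ↑ʳ j) ≡ a i j
    edge-↑ˡ-↑ʳ i j rewrite splitAt-↑ˡ p i q | splitAt-↑ʳ p q j | lookup-++ˡ xs ys i | lookup-++ʳ xs ys j = refl

    edge-↑ʳ-↑ˡ : ∀ j i → edge (p ↑ʳ j) (i ↑ˡ q) ≡ a i j
    edge-↑ʳ-↑ˡ j i rewrite splitAt-↑ʳ p q j | splitAt-↑ˡ p i q | lookup-++ˡ xs ys i | lookup-++ʳ xs ys j =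
      undirected (lookup ys j) (lookup xs i)

    edge-↑ʳ-↑ʳ : ∀ j j′ → edge (p ↑ʳ j) (p ↑ʳ j′) ≡ true
    edge-↑ʳ-↑ʳ j j′ rewrite splitAt-↑ʳ p q j | splitAt-↑ʳ p q j′ = refl

    ⋀-edge-↑ˡ : ∀ i → ⋀[ v < p + q ] edge (i ↑ˡ q) v ≡ ⋀[ j < q ] a i j
    ⋀-edge-↑ˡ i = begin
      ⋀[ v < p + q ] edge (i ↑ˡ q) v
        ≡⟨ ⋀-↑ p q (edge (i ↑ˡ q)) ⟩
      ⋀[ i′ < p ] edge (i ↑ˡ q) (i′ ↑ˡ q) ∧ ⋀[ j < q ] edge (i ↑ˡ q) (p ↑ʳ j)
        ≡⟨ cong₂ _∧_ (trans (⋀.sum-cong-≗ (edge-↑ˡ-↑ˡ i)) (⋀-true p))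
                     (⋀.sum-cong-≗ (edge-↑ˡ-↑ʳ i)) ⟩
      ⋀[ j < q ] a i j
        ∎
      where open ≡-Reasoning

    ⋀-edge-↑ʳ : ∀ j → ⋀[ v < p + q ] edge (p ↑ʳ j) v ≡ ⋀[ i < p ] a i j
    ⋀-edge-↑ʳ j = begin
      ⋀[ v < p + q ] edge (p ↑ʳ j) v
        ≡⟨ ⋀-↑ p q (edge (p ↑ʳ j)) ⟩
      ⋀[ i < p ] edge (p ↑ʳ j) (i ↑ˡ q) ∧ ⋀[ j′ < q ] edge (p ↑ʳ j) (p ↑ʳ j′)
        ≡⟨ cong₂ _∧_ (⋀.sum-cong-≗ (λ i → edge-↑ʳ-↑ˡ j i))
                     (trans (⋀.sum-cong-≗ (edge-↑ʳ-↑ʳ j)) (⋀-true q)) ⟩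
      ⋀[ i < p ] a i j ∧ true
        ≡⟨ ∧-identityʳ (⋀[ i < p ] a i j) ⟩
      ⋀[ i < p ] a i j
        ∎
      where open ≡-Reasoning

    isHom-K-++ : isHom (K p q) G (xs ++ᵛ ys) ≡ ⋀[ j < q ] common G xs (lookup ys j)
    isHom-K-++ = begin
      isHom (K p q) G (xs ++ᵛ ys)
        ≡⟨ trans (isHom-⋀ (K p q) G (xs ++ᵛ ys)) (⋀-↑ p q (λ u → ⋀[ v < p + q ] edge u v)) ⟩
      ⋀[ i < p ] ⋀[ v < p + q ] edge (i ↑ˡ q) v ∧ ⋀[ j < q ] ⋀[ v < p + q ] edge (p ↑ʳ j) v
        ≡⟨ cong₂ _∧_ (trans (⋀.sum-cong-≗ ⋀-edge-↑ˡ) (⋀.∑-comm a)) (⋀.sum-cong-≗ ⋀-edge-↑ʳ) ⟩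
      ⋀[ j < q ] ⋀[ i < p ] a i j ∧ ⋀[ j < q ] ⋀[ i < p ] a i j
        ≡⟨ ∧-idem (⋀[ j < q ] ⋀[ i < p ] a i j) ⟩
      ⋀[ j < q ] ⋀[ i < p ] a i j
        ∎
      where open ≡-Reasoning

  hom-K≡∑ᵛ : ∀ p q → hom (K p q) G ≡ ∑ᵛ p (λ xs → count (common G xs) ^ q)
  hom-K≡∑ᵛ p q = begin
    hom (K p q) G
      ≡⟨ length-filter-allVecs (p + q) (isHom (K p q) G) ⟩
    ∑ᵛ (p + q) ([_] ∘ isHom (K p q) G)
      ≡⟨ ∑ᵛ-++ p q _ ⟩
    ∑ᵛ p (λ xs → ∑ᵛ q (λ ys → [ isHom (K p q) G (xs ++ᵛ ys) ]))
      ≡⟨ ∑ᵛ-cong p (λ xs → ∑ᵛ-cong q (λ ys → cong [_] (isHom-K-++ xs ys))) ⟩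
    ∑ᵛ p (λ xs → ∑ᵛ q (λ ys → [ ⋀[ j < q ] common G xs (lookup ys j) ]))
      ≡⟨ ∑ᵛ-cong p (λ xs → ∑ᵛ-all q (common G xs)) ⟩
    ∑ᵛ p (λ xs → count (common G xs) ^ q)
      ∎
    where open ≡-Reasoning

m≤1⇒m^n≡m : ∀ {m} n .{{_ : NonZero n}} → m ≤ 1 → m ^ n ≡ m
m≤1⇒m^n≡m {zero}          (suc n) _         = refl
m≤1⇒m^n≡m {suc zero}      (suc n) _         = ^-zeroˡ (suc n)
m≤1⇒m^n≡m {suc (suc m)}   (suc n) (s≤s ())

module _ (G : Graph) (undirected : Undirected G) {d : ℕ} (regular : Regular d G)
         (q : ℕ) .{{_ : NonZero q}} where

  private
    n = size G
    N = adj G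

  -- homK m T counts the homomorphisms K_{m,q} → G that map the q-side into T.
  homK : ℕ → (Fin n → Bool) → ℕ
  homK m T = ∑ᵛ m (λ xs → count (T ∩ common G xs) ^ q)

  homK-cong : ∀ m {T T′} → T ≗ T′ → homK m T ≡ homK m T′
  homK-cong m T≗T′ = ∑ᵛ-cong m (λ xs → cong (_^ q) (count-cong (λ y → cong (_∧ common G xs y) (T≗T′ y))))

  homK-suc : ∀ m T → homK (suc m) T ≡ ∑[ u < n ] homK m (T ∩ N u)
  homK-suc m T = sum-cong-≗ (λ u → ∑ᵛ-cong m (λ xs →
    cong (_^ q) (count-cong (λ y → sym (∧-assoc (T y) (N u y) (common G xs y))))))

  homK-N-zero : ∀ u → homK 0 (N u) ≡ d ^ q
  homK-N-zero u = cong (_^ q) (trans (count-cong (λ y → ∧-identityʳ (N u y))) (regular u))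

  hom-K-suc : ∀ p → hom (K (suc p) q) G ≡ ∑[ u < n ] homK p (N u)
  hom-K-suc p = trans (hom-K≡∑ᵛ G undirected (suc p) q) (homK-suc p (λ _ → true))

  count-column : ∀ y → count (λ x → N x y) ≡ d
  count-column y = trans (count-cong (λ x → undirected x y)) (regular y)

  ∑-count-common : ∀ u → ∑[ w < n ] count (N u ∩ N w) ≡ d * d
  ∑-count-common u = begin
    ∑[ w < n ] ∑[ y < n ] [ N u y ∧ N w y ]
      ≡⟨ sum-cong-≗ (λ w → sum-cong-≗ (λ y → [∧] (N u y) (N w y))) ⟩
    ∑[ w < n ] ∑[ y < n ] ([ N u y ] * [ N w y ])
      ≡⟨ ∑-comm (λ w y → [ N u y ] * [ N w y ]) ⟩
    ∑[ y < n ] ∑[ w < n ] ([ N u y ] * [ N w y ])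
      ≡⟨ sum-cong-≗ (λ y → *-distribˡ-sum [ N u y ] (λ w → [ N w y ])) ⟨
    ∑[ y < n ] ([ N u y ] * count (λ w → N w y))
      ≡⟨ sum-cong-≗ (λ y → cong ([ N u y ] *_) (count-column y)) ⟩
    ∑[ y < n ] ([ N u y ] * d)
      ≡⟨ *-distribʳ-sum d ([_] ∘ N u) ⟨
    count (N u) * d
      ≡⟨ cong (_* d) (regular u) ⟩
    d * d
      ∎
    where open ≡-Reasoning

  -- For |T| ≤ 1 the exponent q is irrelevant, and each y lies in N(xs) for exactly d^m tuples xs.
  homK-atMostOne : ∀ m {T} → count T ≤ 1 → homK m T ≡ count T * d ^ m
  homK-atMostOne m {T} count≤1 = begin
    ∑ᵛ m (λ xs → count (T ∩ common G xs) ^ q)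
      ≡⟨ ∑ᵛ-cong m (λ xs → m≤1⇒m^n≡m q (≤-trans (count-∧-≤ T (common G xs)) count≤1)) ⟩
    ∑ᵛ m (λ xs → ∑[ y < n ] [ T y ∧ common G xs y ])
      ≡⟨ ∑ᵛ-cong m (λ xs → sum-cong-≗ (λ y → [∧] (T y) (common G xs y))) ⟩
    ∑ᵛ m (λ xs → ∑[ y < n ] ([ T y ] * [ common G xs y ]))
      ≡⟨ ∑ᵛ-comm m (λ xs y → [ T y ] * [ common G xs y ]) ⟩
    ∑[ y < n ] ∑ᵛ m (λ xs → [ T y ] * [ common G xs y ])
      ≡⟨ sum-cong-≗ (λ y → ∑ᵛ-*ˡ m [ T y ] (λ xs → [ common G xs y ])) ⟩
    ∑[ y < n ] ([ T y ] * ∑ᵛ m (λ xs → [ common G xs y ]))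
      ≡⟨ sum-cong-≗ (λ y → cong ([ T y ] *_) (trans (∑ᵛ-all m (λ x → N x y)) (cong (_^ m) (count-column y)))) ⟩
    ∑[ y < n ] ([ T y ] * d ^ m)
      ≡⟨ *-distribʳ-sum (d ^ m) ([_] ∘ T) ⟨
    count T * d ^ m
      ∎
    where open ≡-Reasoning

  homK-empty : ∀ m {T} → count T ≡ 0 → homK m T ≡ 0
  homK-empty m {T} none = trans (homK-atMostOne m (subst (_≤ 1) (sym none) z≤n)) (cong (_* d ^ m) none)

  module _ (c₄-free : C₄-free G) where

    -- The term w = u is singled out by the indicator [ ⌊ u ≟ w ⌋ ], which keeps subtraction out.
    homK-∩-C₄-free : ∀ m u w →
      homK m (N u ∩ N w) + [ ⌊ u ≟ w ⌋ ] * d ^ suc m ≡ [ ⌊ u ≟ w ⌋ ] * homK m (N u) + count (N u ∩ N w) * d ^ m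
    homK-∩-C₄-free m u w with u ≟ w
    ... | no u≢w  = trans (+-identityʳ _) (homK-atMostOne m (c₄-free u≢w))
    ... | yes refl = begin
      homK m (N u ∩ N u) + 1 * d ^ suc m             ≡⟨ cong₂ _+_ (homK-cong m self) (*-identityˡ (d ^ suc m)) ⟩
      homK m (N u) + d * d ^ m                       ≡⟨ cong₂ _+_ (*-identityˡ _) (cong (_* d ^ m) count-self) ⟨
      1 * homK m (N u) + count (N u ∩ N u) * d ^ m   ∎
      where
      open ≡-Reasoning
      self : N u ∩ N u ≗ N u
      self y = ∧-idem (N u y)
      count-self : count (N u ∩ N u) ≡ d
      count-self = trans (count-cong self) (regular u)

    homK-N-suc : ∀ m u → homK (suc m) (N u) + d ^ suc m ≡ homK m (N u) + d * d ^ suc m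
    homK-N-suc m u = begin
      homK (suc m) (N u) + d ^ suc m
        ≡⟨ cong₂ _+_ (homK-suc m (N u)) (sym (∑-δ (d ^ suc m))) ⟩
      ∑[ w < n ] homK m (N u ∩ N w) + ∑[ w < n ] (δ w * d ^ suc m)
        ≡⟨ ∑-distrib-+ (λ w → homK m (N u ∩ N w)) (λ w → δ w * d ^ suc m) ⟨
      ∑[ w < n ] (homK m (N u ∩ N w) + δ w * d ^ suc m)
        ≡⟨ sum-cong-≗ (homK-∩-C₄-free m u) ⟩
      ∑[ w < n ] (δ w * homK m (N u) + count (N u ∩ N w) * d ^ m)
        ≡⟨ ∑-distrib-+ (λ w → δ w * homK m (N u)) (λ w → count (N u ∩ N w) * d ^ m) ⟩
      ∑[ w < n ] (δ w * homK m (N u)) + ∑[ w < n ] (count (N u ∩ N w) * d ^ m)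
        ≡⟨ cong₂ _+_ (sym (∑-δ (homK m (N u)))) (*-distribʳ-sum (d ^ m) (λ w → count (N u ∩ N w))) ⟨
      homK m (N u) + ∑[ w < n ] count (N u ∩ N w) * d ^ m
        ≡⟨ cong (λ c → homK m (N u) + c * d ^ m) (∑-count-common u) ⟩
      homK m (N u) + d * d * d ^ m
        ≡⟨ cong (homK m (N u) +_) (*-assoc d d (d ^ m)) ⟩
      homK m (N u) + d * d ^ suc m
        ∎
      where
      open ≡-Reasoning
      δ : Fin n → ℕ
      δ w = [ ⌊ u ≟ w ⌋ ]
      ∑-δ : ∀ x → ∑[ w < n ] (δ w * x) ≡ x
      ∑-δ x = trans (sym (*-distribʳ-sum x δ)) (trans (cong (_* x) (count-≟ u)) (*-identityˡ x))

    homK-N : ∀ m u → homK m (N u) + d ≡ d ^ q + d ^ suc m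
    homK-N zero    u = cong₂ _+_ (homK-N-zero u) (sym (*-identityʳ d))
    homK-N (suc m) u = +-cancelʳ-≡ (d ^ suc m) _ _ (begin
      homK (suc m) (N u) + d + d ^ suc m         ≡⟨ xy∙z≈xz∙y (homK (suc m) (N u)) d (d ^ suc m) ⟩
      homK (suc m) (N u) + d ^ suc m + d         ≡⟨ cong (_+ d) (homK-N-suc m u) ⟩
      homK m (N u) + d * d ^ suc m + d           ≡⟨ xy∙z≈xz∙y (homK m (N u)) (d * d ^ suc m) d ⟩
      homK m (N u) + d + d * d ^ suc m           ≡⟨ cong (_+ d * d ^ suc m) (homK-N m u) ⟩
      d ^ q + d ^ suc m + d * d ^ suc m          ≡⟨ xy∙z≈xz∙y (d ^ q) (d ^ suc m) (d * d ^ suc m) ⟩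
      d ^ q + d ^ suc (suc m) + d ^ suc m        ∎)
      where open ≡-Reasoning

    hom-K-C₄-free : ∀ p → hom (K (suc p) q) G ≡ n * (d ^ suc p + d ^ q ∸ d)
    hom-K-C₄-free p = begin
      hom (K (suc p) q) G                  ≡⟨ hom-K-suc p ⟩
      ∑[ u < n ] homK p (N u)              ≡⟨ sum-cong-≗ homK-N-value ⟩
      ∑[ u < n ] (d ^ suc p + d ^ q ∸ d)   ≡⟨ ∑-const n _ ⟩
      n * (d ^ suc p + d ^ q ∸ d)          ∎
      where
      open ≡-Reasoning
      homK-N-value : ∀ u → homK p (N u) ≡ d ^ suc p + d ^ q ∸ d
      homK-N-value u = begin
        homK p (N u)              ≡⟨ m+n∸n≡m (homK p (N u)) d ⟨
        homK p (N u) + d ∸ d      ≡⟨ cong (_∸ d) (trans (homK-N p u) (+-comm (d ^ q) _)) ⟩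
        d ^ suc p + d ^ q ∸ d     ∎

  module _ (equal-or-disjoint : NeighbourhoodsEqualOrDisjoint G) .{{_ : NonZero d}} where

    homK-∩-equal-or-disjoint : ∀ m u w → d * homK m (N u ∩ N w) ≡ count (N u ∩ N w) * homK m (N u)
    homK-∩-equal-or-disjoint m u w with equal-or-disjoint u w
    ... | inj₁ equal    = begin
      d * homK m (N u ∩ N w)                 ≡⟨ cong (d *_) (homK-cong m equal) ⟩
      d * homK m (N u)                       ≡⟨ cong (_* homK m (N u)) (trans (count-cong equal) (regular u)) ⟨
      count (N u ∩ N w) * homK m (N u)       ∎
      where open ≡-Reasoning
    ... | inj₂ disjoint = begin
      d * homK m (N u ∩ N w)                 ≡⟨ cong (d *_) (homK-empty m none) ⟩
      d * 0                                  ≡⟨ *-zeroʳ d ⟩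
      0                                      ≡⟨ cong (_* homK m (N u)) none ⟨
      count (N u ∩ N w) * homK m (N u)       ∎
      where
      open ≡-Reasoning
      none : count (N u ∩ N w) ≡ 0
      none = trans (count-cong disjoint) (sum-replicate-zero n)

    homK-N-equal-or-disjoint : ∀ m u → homK m (N u) ≡ d ^ m * d ^ q
    homK-N-equal-or-disjoint zero    u = trans (homK-N-zero u) (sym (*-identityˡ (d ^ q)))
    homK-N-equal-or-disjoint (suc m) u = *-cancelˡ-≡ _ _ d (begin
      d * homK (suc m) (N u)
        ≡⟨ cong (d *_) (homK-suc m (N u)) ⟩
      d * ∑[ w < n ] homK m (N u ∩ N w)
        ≡⟨ *-distribˡ-sum d (λ w → homK m (N u ∩ N w)) ⟩
      ∑[ w < n ] (d * homK m (N u ∩ N w))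
        ≡⟨ sum-cong-≗ (homK-∩-equal-or-disjoint m u) ⟩
      ∑[ w < n ] (count (N u ∩ N w) * homK m (N u))
        ≡⟨ *-distribʳ-sum (homK m (N u)) (λ w → count (N u ∩ N w)) ⟨
      ∑[ w < n ] count (N u ∩ N w) * homK m (N u)
        ≡⟨ cong₂ _*_ (∑-count-common u) (homK-N-equal-or-disjoint m u) ⟩
      d * d * (d ^ m * d ^ q)
        ≡⟨ *-assoc d d (d ^ m * d ^ q) ⟩
      d * (d * (d ^ m * d ^ q))
        ≡⟨ cong (d *_) (*-assoc d (d ^ m) (d ^ q)) ⟨
      d * (d ^ suc m * d ^ q)
        ∎)
      where open ≡-Reasoning

    hom-K-equal-or-disjoint : ∀ p → hom (K (suc p) q) G ≡ n * d ^ (p + q)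
    hom-K-equal-or-disjoint p = begin
      hom (K (suc p) q) G           ≡⟨ hom-K-suc p ⟩
      ∑[ u < n ] homK p (N u)       ≡⟨ sum-cong-≗ (homK-N-equal-or-disjoint p) ⟩
      ∑[ u < n ] (d ^ p * d ^ q)    ≡⟨ ∑-const n _ ⟩
      n * (d ^ p * d ^ q)           ≡⟨ cong (n *_) (^-distribˡ-+-* d p q) ⟨
      n * d ^ (p + q)               ∎
      where open ≡-Reasoning

-- Cycles

[m+n%d]%d≡[m+n]%d : ∀ m n d .{{_ : NonZero d}} → (m + n % d) % d ≡ (m + n) % d
[m+n%d]%d≡[m+n]%d m n d = begin
  (m + n % d) % d            ≡⟨ %-distribˡ-+ m (n % d) d ⟩
  (m % d + n % d % d) % d    ≡⟨ cong (λ r → (m % d + r) % d) (m%n%n≡m%n n d) ⟩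
  (m % d + n % d) % d        ≡⟨ %-distribˡ-+ m n d ⟨
  (m + n) % d                ∎
  where open ≡-Reasoning

[d+n]%d≡n : ∀ {n} d .{{_ : NonZero d}} → n < d → (d + n) % d ≡ n
[d+n]%d≡n {n} d n<d = trans (cong (_% d) (+-comm d n)) (trans ([m+n]%n≡m%n n d) (m<n⇒m%n≡m n<d))

[k+n]%d≡n⇒k%d≡0 : ∀ k n d .{{_ : NonZero d}} → (k + n) % d ≡ n → k % d ≡ 0
[k+n]%d≡n⇒k%d≡0 k n d fixed = trans (cong (_% d) k≡t*d) (m*n%n≡0 t d)
  where
  open ≡-Reasoning
  t = (k + n) / d
  k≡t*d : k ≡ t * d
  k≡t*d = +-cancelʳ-≡ n k (t * d) (begin
    k + n                ≡⟨ m≡m%n+[m/n]*n (k + n) d ⟩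
    (k + n) % d + t * d  ≡⟨ cong (_+ t * d) fixed ⟩
    n + t * d            ≡⟨ +-comm n (t * d) ⟩
    t * d + n            ∎)

size-C : ∀ n → size (C n) ≡ n
size-C zero    = refl
size-C (suc n) = refl

module Cycle (m : ℕ) where

  -- adj (C (suc m)) i j is by definition (i ↦ j) ∨ (j ↦ i).
  _↦_ : Fin (suc m) → Fin (suc m) → Bool
  i ↦ j = toℕ j ≡ᵇ suc (toℕ i) % suc m

  next : Fin (suc m) → Fin (suc m)
  next i = fromℕ< (m%n<n (suc (toℕ i)) (suc m))

  prev : Fin (suc m) → Fin (suc m)
  prev i = fold i next m

  toℕ-next : ∀ i → toℕ (next i) ≡ suc (toℕ i) % suc m
  toℕ-next i = toℕ-fromℕ< (m%n<n (suc (toℕ i)) (suc m))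

  T-↦ : ∀ {i j} → T (i ↦ j) → j ≡ next i
  T-↦ {i} {j} i↦j = toℕ-injective (trans (≡ᵇ⇒≡ _ _ i↦j) (sym (toℕ-next i)))

  ↦-intro : ∀ {i j} → j ≡ next i → T (i ↦ j)
  ↦-intro {i} refl = ≡⇒≡ᵇ _ _ (toℕ-next i)

  toℕ-fold-next : ∀ k i → toℕ (fold i next k) ≡ (k + toℕ i) % suc m
  toℕ-fold-next zero    i = sym (m<n⇒m%n≡m (toℕ<n i))
  toℕ-fold-next (suc k) i = begin
    toℕ (next (fold i next k))            ≡⟨ toℕ-next (fold i next k) ⟩
    suc (toℕ (fold i next k)) % suc m     ≡⟨ cong (λ x → suc x % suc m) (toℕ-fold-next k i) ⟩
    (1 + (k + toℕ i) % suc m) % suc m     ≡⟨ [m+n%d]%d≡[m+n]%d 1 (k + toℕ i) (suc m) ⟩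
    (suc k + toℕ i) % suc m               ∎
    where open ≡-Reasoning

  next-prev : ∀ i → next (prev i) ≡ i
  next-prev i = toℕ-injective (trans (toℕ-fold-next (suc m) i) ([d+n]%d≡n (suc m) (toℕ<n i)))

  prev-next : ∀ i → prev (next i) ≡ i
  prev-next i = toℕ-injective (begin
    toℕ (fold (next i) next m)          ≡⟨ toℕ-fold-next m (next i) ⟩
    (m + toℕ (next i)) % suc m          ≡⟨ cong (λ x → (m + x) % suc m) (toℕ-next i) ⟩
    (m + suc (toℕ i) % suc m) % suc m   ≡⟨ [m+n%d]%d≡[m+n]%d m (suc (toℕ i)) (suc m) ⟩
    (m + suc (toℕ i)) % suc m           ≡⟨ cong (_% suc m) (+-suc m (toℕ i)) ⟩
    (suc m + toℕ i) % suc m             ≡⟨ [d+n]%d≡n (suc m) (toℕ<n i) ⟩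
    toℕ i                               ∎)
    where open ≡-Reasoning

  next-injective : ∀ {i j} → next i ≡ next j → i ≡ j
  next-injective {i} {j} eq = trans (sym (prev-next i)) (trans (cong prev eq) (prev-next j))

  fold-next-fixed : ∀ k {i} → k % suc m ≢ 0 → fold i next k ≢ i
  fold-next-fixed k {i} k≢0 fixed =
    k≢0 ([k+n]%d≡n⇒k%d≡0 k (toℕ i) (suc m) (trans (sym (toℕ-fold-next k i)) (cong toℕ fixed)))

  regular : 2 % suc m ≢ 0 → Regular 2 (C (suc m))
  regular 2≢0 u = begin
    count (λ y → (u ↦ y) ∨ (y ↦ u))
      ≡⟨ count-∨ (u ↦_) (_↦ u) disjoint ⟩
    count (u ↦_) + count (_↦ u)
      ≡⟨ cong₂ _+_ (count-unique (next u) (↦-intro {u} refl) (T-↦ {u}))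
                   (count-unique (prev u) (↦-intro {prev u} (sym (next-prev u))) unique-pred) ⟩
    2
      ∎
    where
    open ≡-Reasoning
    disjoint : ∀ y → T (u ↦ y) → T (y ↦ u) → ⊥
    disjoint y u↦y y↦u with T-↦ {u} {y} u↦y | T-↦ {y} {u} y↦u
    ... | refl | u≡next² = fold-next-fixed 2 2≢0 (sym u≡next²)
    unique-pred : ∀ {y} → T (y ↦ u) → y ≡ prev u
    unique-pred {y} y↦u = trans (sym (prev-next y)) (cong prev (sym (T-↦ {y} y↦u)))

  undirected : Undirected (C (suc m))
  undirected i j = ∨-comm (i ↦ j) (j ↦ i)

  Adjacent : Fin (suc m) → Fin (suc m) → Set
  Adjacent u y = y ≡ next u ⊎ u ≡ next y

  adjacent : ∀ {u y} → T (adj (C (suc m)) u y) → Adjacent u y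
  adjacent = ⊎-map T-↦ T-↦ ∘ Equivalence.to T-∨

  module _ (4≢0 : 4 % suc m ≢ 0) where

    -- y₁ = u + 1 and y₂ = u - 1 can both be adjacent to w ≠ u only if w = u + 2 and y₂ = w + 1, i.e. u = u + 4.
    successor-and-predecessor : ∀ {u w y₁ y₂} → u ≢ w → y₁ ≡ next u → u ≡ next y₂ →
                              Adjacent w y₁ → Adjacent w y₂ → ⊥
    successor-and-predecessor u≢w refl refl (inj₁ e) _        = u≢w (next-injective e)
    successor-and-predecessor u≢w refl refl _        (inj₂ e) = u≢w (sym e)
    successor-and-predecessor _   refl refl (inj₂ refl) (inj₁ e) = fold-next-fixed 4 4≢0 (sym e)

    common-neighbour-unique : ∀ {u w y₁ y₂} → u ≢ w →
      Adjacent u y₁ → Adjacent w y₁ → Adjacent u y₂ → Adjacent w y₂ → y₁ ≡ y₂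
    common-neighbour-unique _   (inj₁ e₁) _  (inj₁ e₂) _  = trans e₁ (sym e₂)
    common-neighbour-unique _   (inj₂ e₁) _  (inj₂ e₂) _  = next-injective (trans (sym e₁) e₂)
    common-neighbour-unique u≢w (inj₁ e₁) a₁ (inj₂ e₂) a₂ = ⊥-elim (successor-and-predecessor u≢w e₁ e₂ a₁ a₂)
    common-neighbour-unique u≢w (inj₂ e₁) a₁ (inj₁ e₂) a₂ = ⊥-elim (successor-and-predecessor u≢w e₂ e₁ a₂ a₁)

    c₄-free : C₄-free (C (suc m))
    c₄-free u≢w = count-atMostOne _ (λ t₁ t₂ →
      let (u~y₁ , w~y₁) = Equivalence.to T-∧ t₁
          (u~y₂ , w~y₂) = Equivalence.to T-∧ t₂
      in common-neighbour-unique u≢w (adjacent u~y₁) (adjacent w~y₁) (adjacent u~y₂) (adjacent w~y₂))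

C-undirected : ∀ n → Undirected (C n)
C-undirected zero    ()
C-undirected (suc m) = Cycle.undirected m

C-regular : ∀ n → 3 ≤ n → Regular 2 (C n)
C-regular 1 (s≤s ())
C-regular 2 (s≤s (s≤s ()))
C-regular (suc (suc (suc k))) _ = Cycle.regular (2 + k) λ ()

C-C₄-free : ∀ n → 3 ≤ n → n ≢ 4 → C₄-free (C n)
C-C₄-free 1 (s≤s ())
C-C₄-free 2 (s≤s (s≤s ()))
C-C₄-free 3 _ _ = Cycle.c₄-free 2 λ ()
C-C₄-free 4 _ n≢4 = ⊥-elim (n≢4 refl)
C-C₄-free (suc (suc (suc (suc (suc k))))) _ _ = Cycle.c₄-free (4 + k) λ ()

C₄-neighbourhoods : NeighbourhoodsEqualOrDisjoint (C 4)
C₄-neighbourhoods = toWitness {a? = all? λ u → all? λ w →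
  all? (λ y → (N u ∩ N w) y ≟ᵇ N u y) ⊎-dec all? (λ y → (N u ∩ N w) y ≟ᵇ false)} _
  where
  N : Fin 4 → Fin 4 → Bool
  N = adj (C 4)

corollary3 : (p q n : ℕ) → 1 ≤ p → 1 ≤ q → 3 ≤ n →
    ((n ≡ 3 ⊎ 5 ≤ n) → hom (K p q) (C n) ≡ n * (2 ^ p + 2 ^ q ∸ 2)) ×
    (n ≡ 4 → hom (K p q) (C n) ≡ 2 ^ (p + q + 1))
corollary3 (suc p) (suc q) n _ _ 3≤n = not-four , four
  where
  not-four : n ≡ 3 ⊎ 5 ≤ n → hom (K (suc p) (suc q)) (C n) ≡ n * (2 ^ suc p + 2 ^ suc q ∸ 2)
  not-four n≡3⊎5≤n =
    trans (hom-K-C₄-free (C n) (C-undirected n) (C-regular n 3≤n) (suc q) (C-C₄-free n 3≤n (n≢4 n≡3⊎5≤n)) p)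
          (cong (_* (2 ^ suc p + 2 ^ suc q ∸ 2)) (size-C n))
    where
    n≢4 : n ≡ 3 ⊎ 5 ≤ n → n ≢ 4
    n≢4 (inj₂ 5≤4) refl = <-irrefl refl 5≤4

  four : n ≡ 4 → hom (K (suc p) (suc q)) (C n) ≡ 2 ^ (suc p + suc q + 1)
  four refl =
    trans (hom-K-equal-or-disjoint (C 4) (C-undirected 4) (C-regular 4 3≤n) (suc q) C₄-neighbourhoods p)
          (trans (sym (^-distribˡ-+-* 2 2 (p + suc q))) (cong (λ e → 2 ^ suc e) (+-comm 1 (p + suc q))))
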